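{- Let $J$ be a multiset of edges on $V$ satisfying $|\delta_J(X)|\ge f^{\lambda}_r(X)$ for each $X\subseteq V$, and let $v$ be a node in $V\setminus T$ with $|\delta_J(v)|\ne 3$. Then either $\delta_J(v)$ contains a pair of edges that is admissible with respect to $f^{\lambda}_r$, or there is an edge in $\delta_J(v)$ whose removal from $J$ preserves $|\delta_J(X)|\ge f^{\lambda}_r(X)$ for all $X\subseteq V$.
   Context: Let $V$ be a finite node set, $T\subseteq V$, and $r\colon T\to\mathbb{Z}_+$. Define $f^{\lambda}_r\colon 2^V\to\mathbb{Z}_+$ by $f^{\lambda}_r(X)=r(t)$ if $X\cap T=\{t\}$ and $f^{\lambda}_r(X)=0$ otherwise. For an edge multiset $J$ on $V$ and $X\subseteq V$, $\delta_J(X)$ is the set of edges of $J$ with exactly one end in $X$, and $\delta_J(v)=\delta_J(\{v\})$. For two edges $e=uv$ and $e'=u'v$ of $J$ sharing the node $v$, splitting off $e$ and $e'$ replaces both by a single new edge $uu'$. A pair of edges of $J$ incident to the same node is admissible with respect to $f^{\lambda}_r$ if after splitting them off the resulting edge multiset $J''$ still satisfies $|\delta_{J''}(X)|\ge f^{\lambda}_r(X)$ for every $X\subseteq V$. -}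

module Defs where

open import Data.Nat using (ℕ; _≤_)
open import Data.Bool using (Bool; true; false; _∧_; _xor_; if_then_else_)
open import Data.Fin using (Fin; _≟_)
open import Data.List using (List; []; _∷_; length; filterᵇ; allFin)
open import Data.Product using (_×_; proj₁; proj₂; _,_)
open import Relation.Nullary.Decidable using (⌊_⌋)

-- Node set V = Fin n.  Subsets of V are Boolean predicates Fin n → Bool.
-- An edge is an (unordered, represented as ordered) pair of nodes; loops allowed.
Edge : ℕ → Set
Edge n = Fin n × Fin n

-- An edge multiset is a list of edges (multiset = list up to permutation).
EdgeMultiset : ℕ → Set
EdgeMultiset n = List (Edge n)

singleton : {n : ℕ} → Fin n → (Fin n → Bool)
singleton v u = ⌊ u ≟ v ⌋

crosses : {n : ℕ} → (Fin n → Bool) → Edge n → Bool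
crosses X e = X (proj₁ e) xor X (proj₂ e)

δ : {n : ℕ} → EdgeMultiset n → (Fin n → Bool) → EdgeMultiset n
δ J X = filterᵇ (crosses X) J

dJ : {n : ℕ} → EdgeMultiset n → (Fin n → Bool) → ℕ
dJ J X = length (δ J X)

-- f^λ_r(X) = r(t) if X ∩ T = {t}, and 0 otherwise.
-- T is a predicate on V; r is given on all of V but only its values on T are used.
fλ : {n : ℕ} → (T : Fin n → Bool) → (r : Fin n → ℕ) → (Fin n → Bool) → ℕ
fλ T r X with filterᵇ (λ u → X u ∧ T u) (allFin _)
... | t ∷ [] = r t
... | _      = 0

Covers : {n : ℕ} → (T : Fin n → Bool) → (r : Fin n → ℕ) → EdgeMultiset n → Set
Covers T r J = ∀ (X : Fin n → Bool) → fλ T r X ≤ dJ J X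
  where n = _

otherEnd : {n : ℕ} → Fin n → Edge n → Fin n
otherEnd v (a , b) = if ⌊ a ≟ v ⌋ then b else a

splitEdge : {n : ℕ} → Fin n → Edge n → Edge n → Edge n
splitEdge v e e' = (otherEnd v e , otherEnd v e')

-- Suppose that no edge at v can be deleted and no pair at v can be split off, and let D = d(v).
-- A deficient set of J − a, resp. of J after splitting off a and b, shows that every edge at v
-- crosses a tight labelled set X (X ∩ T = {t}, d(X) = r(t)), and every two edges at v cross a
-- common labelled set with d(X) ≤ r(t) + 1. Toggling v ∉ T keeps the label of X, so such a set
-- is crossed by at most (D + 1)/2 edges at v; this excludes D = 1 and D = 2.
-- Describe a labelled set by its side not containing v together with whether v ∈ X. If "v ∈ X"
-- and "v ∈ Y" agree exactly when the labels of X and Y agree, the sides uncross submodularly and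
-- the union of the sides is again labelled; otherwise they uncross posimodularly, which loses
-- every common edge at v twice. Hence a tight set and a set of excess 1 sharing an edge at v
-- can be united. For D ≥ 4, the edges at v crossing a maximal tight set through a form the class
-- of a; distinct classes are disjoint, and their maximal tight sets avoid v and carry distinct
-- labels. Given two classes, a maximal set of excess 1 containing v (with the label of a set
-- crossing both) absorbs them, and the edges at v it misses form one further class of size at
-- least (D − 1)/2. Iterating yields three disjoint such classes, so 3(D − 1)/2 ≤ D, i.e. D ≤ 3.

module Submission where

open import Defs

import Data.Nat.Properties
open import Algebra.Properties.CommutativeSemigroup Data.Nat.Properties.+-commutativeSemigroup
  using (interchange; xy∙z≈xz∙y)
open import Data.Bool using (Bool; true; false; not; _∧_; _∨_; _xor_; if_then_else_)
import Data.Bool as Bool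
open import Data.Bool.Properties
  using (∧-identityʳ; ∧-zeroʳ; ∨-zeroʳ; xor-comm; xor-same; xor-identityʳ; T-≡) renaming (_≟_ to _≟ᵇ_)
open import Data.Empty using (⊥; ⊥-elim)
open import Data.Fin using (Fin; _≟_)
import Data.Fin as Fin
open import Data.Fin.Properties using (any?; all?)
open import Data.Fin.Subset using (Subset)
open import Data.Fin.Subset.Properties using (anySubset?)
open import Data.List using (List; []; _∷_; length; filter; filterᵇ; allFin; map; lookup; removeAt; cartesianProduct; cartesianProductWith)
open import Data.List.Extrema.Nat using (argmax; argmax-all; f[xs]≤f[argmax])
open import Data.List.Membership.Propositional using (_∈_)
open import Data.List.Membership.Propositional.Properties
  using (∈-filter⁺; ∈-filter⁻; ∈-allFin; ∈-cartesianProduct⁺; ∈-cartesianProductWith⁺)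
open import Data.List.Properties using (map-cong)
open import Data.List.Relation.Binary.Permutation.Propositional using (_↭_; ↭-refl; ↭-sym; ↭-trans; prep; swap)
open import Data.List.Relation.Binary.Permutation.Propositional.Properties using (map⁺; drop-∷; ∈-resp-↭)
import Data.List.Relation.Unary.All as All
open import Data.List.Relation.Unary.All.Properties using (all-filter)
open import Data.List.Relation.Unary.AllPairs using (_∷_)
open import Data.List.Relation.Unary.Any using (here; there; index)
open import Data.List.Relation.Unary.Any.Properties using (lookup-index)
open import Data.List.Relation.Unary.Unique.Propositional using (Unique)
open import Data.List.Relation.Unary.Unique.Propositional.Properties using (filter⁺; allFin⁺)
open import Data.Nat using (ℕ; zero; suc; _+_; _*_; _≤_; _<_; z≤n; s≤s; _≤?_; _<?_) renaming (_≟_ to _≟ℕ_)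
open import Data.Nat.ListAction using (sum)
open import Data.Nat.ListAction.Properties using (sum-↭)
open import Data.Nat.Properties
  using ( module ≤-Reasoning; ≤-refl; ≤-reflexive; ≤-trans; ≤-pred; <-irrefl; n≤1+n; ≰⇒>; ≮⇒≥; <⇒≱
        ; +-comm; +-assoc; +-identityʳ; +-suc; +-mono-≤; +-monoˡ-≤; +-monoʳ-≤; +-cancelˡ-≤; +-cancelʳ-≤
        ; m≤m+n; m≤n+m; suc-injective; n≤0⇒n≡0; *-zeroʳ; *-distribˡ-+; *-monoʳ-≤)
open import Data.Nat.Tactic.RingSolver using (solve-∀)
open import Data.Product using (Σ; ∃; ∃-syntax; _×_; _,_; proj₁; proj₂)
open import Data.Sum using (_⊎_; inj₁; inj₂)
import Data.Sum as Sum
import Data.Vec as Vec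
open import Data.Vec.Properties using (lookup∘tabulate)
open import Function using (_∘_)
open import Function.Bundles using (Equivalence)
open import Relation.Binary.PropositionalEquality
open import Relation.Nullary using (¬_; Dec; yes; no)
open import Relation.Nullary.Decidable
  using (⌊_⌋; True; toWitness; map′; decidable-stable; ¬?; _→-dec_; _×-dec_)

∀? : {P : Bool → Set} → (∀ b → Dec (P b)) → Dec (∀ b → P b)
∀? P? with P? true | P? false
... | yes pt | yes pf = yes λ { true → pt ; false → pf }
... | no ¬pt | _      = no λ h → ¬pt (h true)
... | yes _  | no ¬pf = no λ h → ¬pf (h false)

decide : {P : Set} (P? : Dec P) → {True P?} → P
decide _ {p} = toWitness p

diff : Bool → Bool → Bool
diff x y = x ∧ not y

true≢false : true ≢ false
true≢false ()

≢true⇒≡false : ∀ {a} → a ≢ true → a ≡ false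
≢true⇒≡false {false} _ = refl
≢true⇒≡false {true} a≢ = ⊥-elim (a≢ refl)

≢false⇒≡true : ∀ {a} → a ≢ false → a ≡ true
≢false⇒≡true {true} _ = refl
≢false⇒≡true {false} a≢ = ⊥-elim (a≢ refl)

∨-if-not : ∀ {a b} → (a ≡ false → b ≡ true) → a ∨ b ≡ true
∨-if-not {true}  _ = refl
∨-if-not {false} f = f refl

∧-true : ∀ {a b} → a ∧ b ≡ true → a ≡ true × b ≡ true
∧-true {true} {true} _ = refl , refl

⌊≟⌋≡true : {n : ℕ} {u t : Fin n} → ⌊ u ≟ t ⌋ ≡ true → u ≡ t
⌊≟⌋≡true {u = u} {t} eq with u ≟ t
... | yes u≡t = u≡t

xor-cancelʳ : ∀ a b c → (a xor c) xor (b xor c) ≡ a xor b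
xor-cancelʳ = decide (∀? λ _ → ∀? λ _ → ∀? λ _ → _ ≟ᵇ _)

xor-cancelˡ : ∀ c a → (c xor a) xor c ≡ a
xor-cancelˡ = decide (∀? λ _ → ∀? λ _ → _ ≟ᵇ _)

-- Membership of a node u ∈ T in the union, intersection and difference of two labelled sets
-- L and M, computed on their sides: a and b tell whether u is the label of L resp. M, and s and
-- s′ whether v lies in L resp. M.
∨-label : ∀ s s′ a b → (s ≡ s′ → a ≡ b) → (a ≡ true → b ≡ true → s ≡ s′) →
          (s ∨ s′) xor ((a xor s) ∨ (b xor s′)) ≡ (if s then a else b)
∨-label = decide (∀? λ s → ∀? λ s′ → ∀? λ a → ∀? λ b →
  (s ≟ᵇ s′ →-dec a ≟ᵇ b) →-dec (a ≟ᵇ true →-dec b ≟ᵇ true →-dec s ≟ᵇ s′) →-dec _ ≟ᵇ _)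

∧-label : ∀ s s′ a b → (s ≡ s′ → a ≡ b) → (a ≡ true → b ≡ true → s ≡ s′) →
          (s ∧ s′) xor ((a xor s) ∧ (b xor s′)) ≡ (if s then b else a)
∧-label = decide (∀? λ s → ∀? λ s′ → ∀? λ a → ∀? λ b →
  (s ≟ᵇ s′ →-dec a ≟ᵇ b) →-dec (a ≟ᵇ true →-dec b ≟ᵇ true →-dec s ≟ᵇ s′) →-dec _ ≟ᵇ _)

diff-label : ∀ s s′ a b → (s ≡ s′ → a ≡ true → b ≡ true → ⊥) → (¬ s ≡ s′ → a ≡ b) →
             diff s s′ xor diff (a xor s) (b xor s′) ≡ (if s then b else a)
diff-label = decide (∀? λ s → ∀? λ s′ → ∀? λ a → ∀? λ b →
  (s ≟ᵇ s′ →-dec a ≟ᵇ true →-dec b ≟ᵇ true →-dec no λ ()) →-dec (¬? (s ≟ᵇ s′) →-dec a ≟ᵇ b) →-dec _ ≟ᵇ _)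

⌊≟⌋-refl : {n : ℕ} (t : Fin n) → ⌊ t ≟ t ⌋ ≡ true
⌊≟⌋-refl t with t ≟ t
... | yes _   = refl
... | no t≢t = ⊥-elim (t≢t refl)

if-either : ∀ {A : Set} (s : Bool) {x y : A} → (if s then x else y) ≡ x ⊎ (if s then x else y) ≡ y
if-either true  = inj₁ refl
if-either false = inj₂ refl

⌊≟if⌋ : ∀ {n} (s : Bool) {u t t′ : Fin n} → ⌊ u ≟ (if s then t else t′) ⌋ ≡ (if s then ⌊ u ≟ t ⌋ else ⌊ u ≟ t′ ⌋)
⌊≟if⌋ true  = refl
⌊≟if⌋ false = refl

𝟙 : Bool → ℕ
𝟙 true  = 1
𝟙 false = 0

𝟙-mono : ∀ a b → (a ≡ true → b ≡ true) → 𝟙 a ≤ 𝟙 b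
𝟙-mono false _ _ = z≤n
𝟙-mono true  b a⇒b rewrite a⇒b refl = ≤-refl

double≤1⇒≡0 : ∀ {m} → 2 * m ≤ 1 → m ≡ 0
double≤1⇒≡0 {zero}  _ = refl
double≤1⇒≡0 {suc m} (s≤s le) rewrite +-suc m (m + 0) with le
... | ()

half⇒< : ∀ {x m} → 2 * x ≤ 1 + m → 2 ≤ m → x < m
half⇒< {x} {m} 2x≤ 2≤m = ≰⇒> λ m≤x → <-irrefl refl (≤-trans 2≤m (+-cancelʳ-≤ m m 1 (begin
  m + m        ≡⟨ cong (m +_) (+-identityʳ m) ⟨
  2 * m        ≤⟨ *-monoʳ-≤ 2 m≤x ⟩
  2 * x        ≤⟨ 2x≤ ⟩
  1 + m        ∎)))
  where open ≤-Reasoning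

complement-of-half : ∀ {m z y} → m ≤ z + y → 2 * z ≤ 1 + m → m ≤ 2 * y + 1
complement-of-half {m} {z} {y} m≤ 2z≤ = +-cancelˡ-≤ m m (2 * y + 1) (begin
  m + m                  ≤⟨ +-mono-≤ m≤ m≤ ⟩
  (z + y) + (z + y)      ≡⟨ regroup z y ⟩
  2 * z + 2 * y          ≤⟨ +-monoˡ-≤ (2 * y) 2z≤ ⟩
  1 + m + 2 * y          ≡⟨ shuffle m y ⟩
  m + (2 * y + 1)        ∎)
  where
  open ≤-Reasoning
  regroup : ∀ z y → (z + y) + (z + y) ≡ 2 * z + 2 * y
  regroup = solve-∀
  shuffle : ∀ m y → 1 + m + 2 * y ≡ m + (2 * y + 1)
  shuffle = solve-∀

three-halves : ∀ {m x y z} → m ≤ 2 * x + 1 → m ≤ 2 * y + 1 → m ≤ 2 * z + 1 → x + y + z ≤ m → m ≤ 3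
three-halves {m} {x} {y} {z} mx my mz sum≤ = +-cancelʳ-≤ (2 * m) m 3 (begin
  m + 2 * m                                   ≡⟨ triple m ⟩
  m + m + m                                   ≤⟨ +-mono-≤ (+-mono-≤ mx my) mz ⟩
  (2 * x + 1) + (2 * y + 1) + (2 * z + 1)     ≡⟨ regroup x y z ⟩
  2 * (x + y + z) + 3                         ≤⟨ +-monoˡ-≤ 3 (*-monoʳ-≤ 2 sum≤) ⟩
  2 * m + 3                                   ≡⟨ +-comm (2 * m) 3 ⟩
  3 + 2 * m                                   ∎)
  where
  open ≤-Reasoning
  triple : ∀ m → m + 2 * m ≡ m + m + m
  triple = solve-∀
  regroup : ∀ x y z → (2 * x + 1) + (2 * y + 1) + (2 * z + 1) ≡ 2 * (x + y + z) + 3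
  regroup = solve-∀

module _ {A : Set} where

  Σ⟨_⟩ : (A → ℕ) → List A → ℕ
  Σ⟨ f ⟩ xs = sum (map f xs)

  count : (A → Bool) → List A → ℕ
  count P = Σ⟨ 𝟙 ∘ P ⟩

  Σ-mono : {f g : A → ℕ} (xs : List A) → (∀ {x} → x ∈ xs → f x ≤ g x) → Σ⟨ f ⟩ xs ≤ Σ⟨ g ⟩ xs
  Σ-mono []       _   = z≤n
  Σ-mono (x ∷ xs) f≤g = +-mono-≤ (f≤g (here refl)) (Σ-mono xs (f≤g ∘ there))

  Σ-+ : (f g : A → ℕ) (xs : List A) → Σ⟨ (λ x → f x + g x) ⟩ xs ≡ Σ⟨ f ⟩ xs + Σ⟨ g ⟩ xs
  Σ-+ f g []       = refl
  Σ-+ f g (x ∷ xs) = trans (cong (f x + g x +_) (Σ-+ f g xs)) (interchange (f x) (g x) _ _)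

  Σ-* : (k : ℕ) (f : A → ℕ) (xs : List A) → Σ⟨ (λ x → k * f x) ⟩ xs ≡ k * Σ⟨ f ⟩ xs
  Σ-* k f []       = sym (*-zeroʳ k)
  Σ-* k f (x ∷ xs) = trans (cong (k * f x +_) (Σ-* k f xs)) (sym (*-distribˡ-+ k (f x) _))

  Σ-cong : {f g : A → ℕ} (xs : List A) → (∀ x → f x ≡ g x) → Σ⟨ f ⟩ xs ≡ Σ⟨ g ⟩ xs
  Σ-cong xs f≗g = cong sum (map-cong f≗g xs)

  Σ-↭ : (f : A → ℕ) {xs ys : List A} → xs ↭ ys → Σ⟨ f ⟩ xs ≡ Σ⟨ f ⟩ ys
  Σ-↭ f p = sum-↭ (map⁺ f p)

  length-filterᵇ : (P : A → Bool) (xs : List A) → length (filterᵇ P xs) ≡ count P xs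
  length-filterᵇ P [] = refl
  length-filterᵇ P (x ∷ xs) with P x
  ... | true  = cong suc (length-filterᵇ P xs)
  ... | false = length-filterᵇ P xs

  count-mono : {P Q : A → Bool} (xs : List A) → (∀ {x} → x ∈ xs → P x ≡ true → Q x ≡ true) → count P xs ≤ count Q xs
  count-mono {P} {Q} xs P⇒Q = Σ-mono xs λ {x} x∈ → 𝟙-mono (P x) (Q x) (P⇒Q x∈)

  count-< : {P Q : A → Bool} (xs : List A) → (∀ {x} → x ∈ xs → P x ≡ true → Q x ≡ true) →
            ∀ {x} → x ∈ xs → Q x ≡ true → P x ≡ false → count P xs < count Q xs
  count-< {P} {Q} (y ∷ ys) P⇒Q (here refl) Qx Px rewrite Qx | Px = s≤s (count-mono ys (P⇒Q ∘ there))
  count-< {P} {Q} (y ∷ ys) P⇒Q (there x∈) Qx Px =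
    ≤-trans (≤-reflexive (sym (+-suc (𝟙 (P y)) _)))
            (+-mono-≤ (𝟙-mono (P y) (Q y) (P⇒Q (here refl))) (count-< ys (P⇒Q ∘ there) x∈ Qx Px))

  private
    there-∃ : ∀ {R : A → Set} {y ys} → (∃ λ x → x ∈ ys × R x) → ∃ λ x → x ∈ y ∷ ys × R x
    there-∃ (x , x∈ , r) = x , there x∈ , r

  count-<⇒∃ : {P Q : A → Bool} (xs : List A) → count P xs < count Q xs → ∃ λ x → x ∈ xs × Q x ≡ true × P x ≡ false
  count-<⇒∃ {P} {Q} (y ∷ ys) lt with P y in Py | Q y in Qy
  ... | false | true  = y , here refl , Qy , Py
  ... | true  | true  = there-∃ (count-<⇒∃ ys (≤-pred lt))
  ... | false | false = there-∃ (count-<⇒∃ ys lt)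
  ... | true  | false = there-∃ (count-<⇒∃ ys (≤-trans (n≤1+n _) lt))

  count-pos⇒∃ : {P : A → Bool} (xs : List A) → 0 < count P xs → ∃ λ x → x ∈ xs × P x ≡ true
  count-pos⇒∃ {P} xs pos with count-<⇒∃ {P = λ _ → false} xs (subst (_< count P xs) (sym (count-false xs)) pos)
    where
    count-false : (ys : List A) → count (λ _ → false) ys ≡ 0
    count-false []       = refl
    count-false (_ ∷ ys) = count-false ys
  ... | x , x∈ , Px , _ = x , x∈ , Px

  count-∨ : {P Q : A → Bool} (xs : List A) → count (λ x → P x ∨ Q x) xs ≤ count P xs + count Q xs
  count-∨ {P} {Q} xs = ≤-trans (Σ-mono xs λ {x} _ → 𝟙-∨ (P x) (Q x)) (≤-reflexive (Σ-+ (𝟙 ∘ P) (𝟙 ∘ Q) xs))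
    where
    𝟙-∨ : ∀ a b → 𝟙 (a ∨ b) ≤ 𝟙 a + 𝟙 b
    𝟙-∨ = decide (∀? λ _ → ∀? λ _ → _ ≤? _)

  count-≡0 : {P : A → Bool} (xs : List A) → count P xs ≡ 0 → ∀ {x} → x ∈ xs → P x ≡ false
  count-≡0 {P} (y ∷ ys) eq (here refl) with P y
  ... | false = refl
  count-≡0 {P} (y ∷ ys) eq (there x∈) with P y
  ... | false = count-≡0 ys eq x∈

module _ {A : Set} where

  removeAt-↭ : (xs : List A) (i : Fin (length xs)) → xs ↭ lookup xs i ∷ removeAt xs i
  removeAt-↭ (x ∷ xs) Fin.zero    = ↭-refl
  removeAt-↭ (x ∷ xs) (Fin.suc i) = ↭-trans (prep x (removeAt-↭ xs i)) (swap x _ ↭-refl)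

  ∈⇒↭∷ : ∀ {x xs} → x ∈ xs → ∃ λ ys → xs ↭ x ∷ ys
  ∈⇒↭∷ {xs = xs} x∈xs = removeAt xs i , subst (λ y → xs ↭ y ∷ removeAt xs i) (sym (lookup-index x∈xs)) (removeAt-↭ xs i)
    where i = index x∈xs

  ∈-∈-≢⇒↭∷∷ : ∀ {x y xs} → x ∈ xs → y ∈ xs → x ≢ y → ∃ λ ys → xs ↭ x ∷ y ∷ ys
  ∈-∈-≢⇒↭∷∷ x∈xs y∈xs x≢y with ∈⇒↭∷ x∈xs
  ... | zs , xs↭ with ∈-resp-↭ xs↭ y∈xs
  ...   | here y≡x = ⊥-elim (x≢y (sym y≡x))
  ...   | there y∈zs with ∈⇒↭∷ y∈zs
  ...     | ys , zs↭ = ys , ↭-trans xs↭ (prep _ zs↭)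

  ∃-removal? : (P : A → List A → Set) → (∀ {a K K′} → K ↭ K′ → P a K → P a K′) → (∀ a K → Dec (P a K)) →
               (xs : List A) → Dec (∃[ a ] ∃[ K ] (xs ↭ a ∷ K × P a K))
  ∃-removal? P resp P? xs with any? (λ i → P? (lookup xs i) (removeAt xs i))
  ... | yes (i , p) = yes (lookup xs i , removeAt xs i , removeAt-↭ xs i , p)
  ... | no ¬p = no λ (a , K , xs↭ , pa) → ¬p (found a K xs↭ pa)
    where
    found : ∀ a K → xs ↭ a ∷ K → P a K → ∃ λ i → P (lookup xs i) (removeAt xs i)
    found a K xs↭ pa = i , subst (λ b → P b (removeAt xs i)) a≡ (resp (drop-∷ (↭-trans (↭-sym xs↭) xs↭′)) pa)
      where
      a∈xs = ∈-resp-↭ (↭-sym xs↭) (here refl)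
      i = index a∈xs
      a≡ = lookup-index a∈xs
      xs↭′ : xs ↭ a ∷ removeAt xs i
      xs↭′ = subst (λ b → xs ↭ b ∷ removeAt xs i) (sym a≡) (removeAt-↭ xs i)

  ∃-removal²? : (P : A → A → List A → Set) → (∀ {a b K K′} → K ↭ K′ → P a b K → P a b K′) → (∀ a b K → Dec (P a b K)) →
                (xs : List A) → Dec (∃[ a ] ∃[ b ] ∃[ K ] (xs ↭ a ∷ b ∷ K × P a b K))
  ∃-removal²? P resp P? xs = map′ flatten nest (∃-removal? P′ resp′ (λ a → ∃-removal? (P a) resp (P? a)) xs)
    where
    P′ : A → List A → Set
    P′ a K₁ = ∃[ b ] ∃[ K ] (K₁ ↭ b ∷ K × P a b K)
    resp′ : ∀ {a K K′} → K ↭ K′ → P′ a K → P′ a K′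
    resp′ K↭ (b , K , K₁↭ , p) = b , K , ↭-trans (↭-sym K↭) K₁↭ , p
    flatten : (∃[ a ] ∃[ K₁ ] (xs ↭ a ∷ K₁ × P′ a K₁)) → ∃[ a ] ∃[ b ] ∃[ K ] (xs ↭ a ∷ b ∷ K × P a b K)
    flatten (a , K₁ , xs↭ , b , K , K₁↭ , p) = a , b , K , ↭-trans xs↭ (prep a K₁↭) , p
    nest : (∃[ a ] ∃[ b ] ∃[ K ] (xs ↭ a ∷ b ∷ K × P a b K)) → ∃[ a ] ∃[ K₁ ] (xs ↭ a ∷ K₁ × P′ a K₁)
    nest (a , b , K , xs↭ , p) = a , b ∷ K , xs↭ , b , K , ↭-refl , p

module _ {A : Set} (xs : List A) (complete : ∀ x → x ∈ xs) {P : A → Set} (P? : ∀ x → Dec (P x)) (f : A → ℕ) where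

  argmax-exists : ∃ P → ∃ λ x → P x × (∀ y → P y → f y ≤ f x)
  argmax-exists (x₀ , px₀) =
    argmax f x₀ (filter P? xs) ,
    argmax-all f px₀ (all-filter P? xs) ,
    λ y py → All.lookup (f[xs]≤f[argmax] x₀ (filter P? xs)) (∈-filter⁺ P? (complete y) py)

subsets : (n : ℕ) → List (Subset n)
subsets zero    = Vec.[] ∷ []
subsets (suc n) = cartesianProductWith Vec._∷_ (true ∷ false ∷ []) (subsets n)

∈-subsets : {n : ℕ} (X : Subset n) → X ∈ subsets n
∈-subsets Vec.[]          = here refl
∈-subsets (true Vec.∷ X)  = ∈-cartesianProductWith⁺ Vec._∷_ {xs = true ∷ false ∷ []} (here refl) (∈-subsets X)
∈-subsets (false Vec.∷ X) = ∈-cartesianProductWith⁺ Vec._∷_ {xs = true ∷ false ∷ []} (there (here refl)) (∈-subsets X)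

-- Cuts of edge multisets

_⟪_⟫_ : {n : ℕ} → (Fin n → Bool) → (Bool → Bool → Bool) → (Fin n → Bool) → Fin n → Bool
(X ⟪ op ⟫ Y) u = op (X u) (Y u)

module _ {n : ℕ} where

  dJ≡count : (K : EdgeMultiset n) (X : Fin n → Bool) → dJ K X ≡ count (crosses X) K
  dJ≡count K X = length-filterᵇ (crosses X) K

  dJ-cong : (K : EdgeMultiset n) (X Y : Fin n → Bool) → (∀ e → crosses X e ≡ crosses Y e) → dJ K X ≡ dJ K Y
  dJ-cong K X Y X≈Y = trans (dJ≡count K X) (trans (Σ-cong K (cong 𝟙 ∘ X≈Y)) (sym (dJ≡count K Y)))

  crosses-cong : {X Y : Fin n → Bool} → (∀ u → X u ≡ Y u) → ∀ e → crosses X e ≡ crosses Y e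
  crosses-cong X≗Y (p , q) = cong₂ _xor_ (X≗Y p) (X≗Y q)

  dJ-∷ : (a : Edge n) (K : EdgeMultiset n) (X : Fin n → Bool) → dJ (a ∷ K) X ≡ 𝟙 (crosses X a) + dJ K X
  dJ-∷ a K X = trans (dJ≡count (a ∷ K) X) (cong (𝟙 (crosses X a) +_) (sym (dJ≡count K X)))

  dJ-↭ : {K K′ : EdgeMultiset n} (X : Fin n → Bool) → K ↭ K′ → dJ K X ≡ dJ K′ X
  dJ-↭ {K} {K′} X K↭ = trans (dJ≡count K X) (trans (Σ-↭ (𝟙 ∘ crosses X) K↭) (sym (dJ≡count K′ X)))

  submodular : (K : EdgeMultiset n) (A B : Fin n → Bool) →
               dJ K (A ⟪ _∧_ ⟫ B) + dJ K (A ⟪ _∨_ ⟫ B) ≤ dJ K A + dJ K B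
  submodular K A B = begin
    dJ K (A ⟪ _∧_ ⟫ B) + dJ K (A ⟪ _∨_ ⟫ B)
      ≡⟨ cong₂ _+_ (dJ≡count K (A ⟪ _∧_ ⟫ B)) (dJ≡count K (A ⟪ _∨_ ⟫ B)) ⟩
    count (crosses (A ⟪ _∧_ ⟫ B)) K + count (crosses (A ⟪ _∨_ ⟫ B)) K
      ≡⟨ Σ-+ _ _ K ⟨
    Σ⟨ (λ e → 𝟙 (crosses (A ⟪ _∧_ ⟫ B) e) + 𝟙 (crosses (A ⟪ _∨_ ⟫ B) e)) ⟩ K
      ≤⟨ Σ-mono K (λ {(p , q)} _ → edge (A p) (A q) (B p) (B q)) ⟩
    Σ⟨ (λ e → 𝟙 (crosses A e) + 𝟙 (crosses B e)) ⟩ K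
      ≡⟨ Σ-+ _ _ K ⟩
    count (crosses A) K + count (crosses B) K
      ≡⟨ cong₂ _+_ (dJ≡count K A) (dJ≡count K B) ⟨
    dJ K A + dJ K B ∎
    where
    open ≤-Reasoning
    edge : ∀ a₁ a₂ b₁ b₂ → 𝟙 ((a₁ ∧ b₁) xor (a₂ ∧ b₂)) + 𝟙 ((a₁ ∨ b₁) xor (a₂ ∨ b₂)) ≤ 𝟙 (a₁ xor a₂) + 𝟙 (b₁ xor b₂)
    edge = decide (∀? λ _ → ∀? λ _ → ∀? λ _ → ∀? λ _ → _ ≤? _)

  posimodular : (K : EdgeMultiset n) (A B : Fin n → Bool) →
                dJ K (A ⟪ diff ⟫ B) + dJ K (B ⟪ diff ⟫ A)
                  + 2 * count (λ e → crosses (A ⟪ _∧_ ⟫ B) e ∧ crosses (A ⟪ _∨_ ⟫ B) e) K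
                ≤ dJ K A + dJ K B
  posimodular K A B = begin
    dJ K (A ⟪ diff ⟫ B) + dJ K (B ⟪ diff ⟫ A) + 2 * count between K
      ≡⟨ cong₂ (λ x y → x + y + 2 * count between K) (dJ≡count K (A ⟪ diff ⟫ B)) (dJ≡count K (B ⟪ diff ⟫ A)) ⟩
    count (crosses (A ⟪ diff ⟫ B)) K + count (crosses (B ⟪ diff ⟫ A)) K + 2 * count between K
      ≡⟨ cong₂ _+_ (Σ-+ _ _ K) (Σ-* 2 (𝟙 ∘ between) K) ⟨
    Σ⟨ (λ e → 𝟙 (crosses (A ⟪ diff ⟫ B) e) + 𝟙 (crosses (B ⟪ diff ⟫ A) e)) ⟩ K + Σ⟨ (λ e → 2 * 𝟙 (between e)) ⟩ K
      ≡⟨ Σ-+ _ _ K ⟨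
    Σ⟨ (λ e → 𝟙 (crosses (A ⟪ diff ⟫ B) e) + 𝟙 (crosses (B ⟪ diff ⟫ A) e) + 2 * 𝟙 (between e)) ⟩ K
      ≤⟨ Σ-mono K (λ {(p , q)} _ → edge (A p) (A q) (B p) (B q)) ⟩
    Σ⟨ (λ e → 𝟙 (crosses A e) + 𝟙 (crosses B e)) ⟩ K
      ≡⟨ Σ-+ _ _ K ⟩
    count (crosses A) K + count (crosses B) K
      ≡⟨ cong₂ _+_ (dJ≡count K A) (dJ≡count K B) ⟨
    dJ K A + dJ K B ∎
    where
    open ≤-Reasoning
    between : Edge n → Bool
    between e = crosses (A ⟪ _∧_ ⟫ B) e ∧ crosses (A ⟪ _∨_ ⟫ B) e
    edge : ∀ a₁ a₂ b₁ b₂ → 𝟙 ((a₁ ∧ not b₁) xor (a₂ ∧ not b₂)) + 𝟙 ((b₁ ∧ not a₁) xor (b₂ ∧ not a₂))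
                             + 2 * 𝟙 (((a₁ ∧ b₁) xor (a₂ ∧ b₂)) ∧ ((a₁ ∨ b₁) xor (a₂ ∨ b₂)))
                           ≤ 𝟙 (a₁ xor a₂) + 𝟙 (b₁ xor b₂)
    edge = decide (∀? λ _ → ∀? λ _ → ∀? λ _ → ∀? λ _ → _ ≤? _)

  crosses-shift : (X : Fin n → Bool) (c : Bool) (e : Edge n) → crosses (λ u → X u xor c) e ≡ crosses X e
  crosses-shift X c (p , q) = xor-cancelʳ (X p) (X q) c

  crosses-at : (v : Fin n) {e : Edge n} → crosses (singleton v) e ≡ true →
               (X : Fin n → Bool) → crosses X e ≡ X v xor X (otherEnd v e)
  crosses-at v {p , q} atv X with p ≟ v | q ≟ v
  ... | yes refl | _        = refl
  ... | no _     | yes refl = xor-comm (X p) (X v)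
  crosses-at v {p , q} () X | no _ | no _

-- Labelled sets

module Labels {n : ℕ} (T : Fin n → Bool) (r : Fin n → ℕ) where

  Labelled : (Fin n → Bool) → Fin n → Set
  Labelled X t = ∀ u → X u ∧ T u ≡ ⌊ u ≟ t ⌋

  labelled? : (X : Fin n → Bool) (t : Fin n) → Dec (Labelled X t)
  labelled? X t = all? λ u → X u ∧ T u ≟ᵇ ⌊ u ≟ t ⌋

  private
    filter-allFin≡[_] : {P : Fin n → Bool} (t : Fin n) → (∀ u → P u ≡ ⌊ u ≟ t ⌋) → filterᵇ P (allFin n) ≡ t ∷ []
    filter-allFin≡[_] {P} t P≗ = unique-singleton (filter⁺ (Bool.T? ∘ P) (allFin⁺ n)) t∈
      (λ u∈ → only (proj₂ (∈-filter⁻ (Bool.T? ∘ P) {xs = allFin n} u∈)))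
      where
      t∈ : t ∈ filterᵇ P (allFin n)
      t∈ = ∈-filter⁺ (Bool.T? ∘ P) (∈-allFin t) (Equivalence.from T-≡ (trans (P≗ t) (⌊≟⌋-refl t)))
      only : ∀ {u} → Bool.T (P u) → u ≡ t
      only {u} Pu with u ≟ t | P≗ u
      ... | yes u≡t | _  = u≡t
      ... | no _    | eq = ⊥-elim (subst Bool.T eq Pu)
      unique-singleton : ∀ {ys} → Unique ys → t ∈ ys → (∀ {u} → u ∈ ys → u ≡ t) → ys ≡ t ∷ []
      unique-singleton {y ∷ []}    _                     _ all≡ = cong (_∷ []) (all≡ (here refl))
      unique-singleton {y ∷ z ∷ _} ((y≢z All.∷ _) ∷ _) _ all≡ =
        ⊥-elim (y≢z (trans (all≡ (here refl)) (sym (all≡ (there (here refl))))))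

    filter-allFin≡[_]⁻ : {P : Fin n → Bool} (t : Fin n) → filterᵇ P (allFin n) ≡ t ∷ [] → ∀ u → P u ≡ ⌊ u ≟ t ⌋
    filter-allFin≡[_]⁻ {P} t eq u with u ≟ t
    ... | yes refl = Equivalence.to T-≡ (proj₂ (∈-filter⁻ (Bool.T? ∘ P) {xs = allFin n} (subst (t ∈_) (sym eq) (here refl))))
    ... | no u≢t with P u in Pu
    ...   | false = refl
    ...   | true  = ⊥-elim (u≢t (u∈[t] (subst (u ∈_) eq (∈-filter⁺ (Bool.T? ∘ P) (∈-allFin u) (Equivalence.from T-≡ Pu)))))
      where
      u∈[t] : u ∈ t ∷ [] → u ≡ t
      u∈[t] (here u≡t) = u≡t

  fλ-labelled : {X : Fin n → Bool} {t : Fin n} → Labelled X t → fλ T r X ≡ r t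
  fλ-labelled {X} {t} lab with filterᵇ (λ u → X u ∧ T u) (allFin n) | filter-allFin≡[ t ] lab
  ... | _ | refl = refl

  fλ-zero-or-labelled : (X : Fin n → Bool) → fλ T r X ≡ 0 ⊎ ∃ λ t → Labelled X t × fλ T r X ≡ r t
  fλ-zero-or-labelled X with filterᵇ (λ u → X u ∧ T u) (allFin n) in eq
  ... | []        = inj₁ refl
  ... | t ∷ []    = inj₂ (t , filter-allFin≡[ t ]⁻ eq , refl)
  ... | _ ∷ _ ∷ _ = inj₁ refl

  Labelled-cong : {X Y : Fin n → Bool} {t : Fin n} → (∀ u → X u ≡ Y u) → Labelled X t → Labelled Y t
  Labelled-cong X≗Y lab u = trans (cong (_∧ T u) (sym (X≗Y u))) (lab u)

  labelled-⟪⟫ : (F : Bool → Bool → Bool) {X Y : Fin n → Bool} {t t′ s : Fin n} → Labelled X t → Labelled Y t′ →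
                (∀ u → F ⌊ u ≟ t ⌋ ⌊ u ≟ t′ ⌋ ≡ ⌊ u ≟ s ⌋) → s ≡ t ⊎ s ≡ t′ → Labelled (X ⟪ F ⟫ Y) s
  labelled-⟪⟫ F {X} {Y} labX labY F≗ s≡ u with T u in Tu
  ... | true  = trans (∧-identityʳ _) (trans (cong₂ F (inside labX) (inside labY)) (F≗ u))
    where
    inside : ∀ {Z t} → Labelled Z t → Z u ≡ ⌊ u ≟ t ⌋
    inside {Z} lab = trans (sym (∧-identityʳ (Z u))) (trans (cong (Z u ∧_) (sym Tu)) (lab u))
  ... | false = trans (∧-zeroʳ _) (sym (outside s≡))
    where
    outside : ∀ {s} → s ≡ _ ⊎ s ≡ _ → ⌊ u ≟ s ⌋ ≡ false
    outside (inj₁ refl) = trans (sym (labX u)) (trans (cong (X u ∧_) Tu) (∧-zeroʳ (X u)))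
    outside (inj₂ refl) = trans (sym (labY u)) (trans (cong (Y u ∧_) Tu) (∧-zeroʳ (Y u)))

  record LabelledSet : Set where
    constructor labelledSet
    field
      set      : Subset n
      label    : Fin n
      labelled : Labelled (Vec.lookup set) label

  open LabelledSet public

  ⟦_⟧ : LabelledSet → Fin n → Bool
  ⟦ L ⟧ = Vec.lookup (set L)

  covered-or-deficient : (K : EdgeMultiset n) → Covers T r K ⊎ ∃ λ L → dJ K ⟦ L ⟧ < r (label L)
  covered-or-deficient K with anySubset? (λ X → any? λ t → labelled? (Vec.lookup X) t ×-dec dJ K (Vec.lookup X) <? r t)
  ... | yes (X , t , lab , short) = inj₂ (labelledSet X t lab , short)
  ... | no none = inj₁ covers
    where
    covers : Covers T r K
    covers X with fλ-zero-or-labelled X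
    ... | inj₁ fλ≡0 = subst (_≤ dJ K X) (sym fλ≡0) z≤n
    ... | inj₂ (t , lab , fλ≡) = begin
      fλ T r X                         ≡⟨ fλ≡ ⟩
      r t                              ≤⟨ ≮⇒≥ (λ short → none (X′ , t , Labelled-cong (sym ∘ X′≗X) lab , short)) ⟩
      dJ K (Vec.lookup X′)             ≡⟨ dJ-cong K (Vec.lookup X′) X (crosses-cong X′≗X) ⟩
      dJ K X                           ∎
      where
      open ≤-Reasoning
      X′ = Vec.tabulate X
      X′≗X : ∀ u → Vec.lookup X′ u ≡ X u
      X′≗X = lookup∘tabulate X

  covers? : (K : EdgeMultiset n) → Dec (Covers T r K)
  covers? K with covered-or-deficient K
  ... | inj₁ covers     = yes covers
  ... | inj₂ (L , short) = no λ covers → <⇒≱ short (subst (_≤ dJ K ⟦ L ⟧) (fλ-labelled (labelled L)) (covers ⟦ L ⟧))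

  Covers-↭ : {K K′ : EdgeMultiset n} → K ↭ K′ → Covers T r K → Covers T r K′
  Covers-↭ K↭ covers X = subst (fλ T r X ≤_) (dJ-↭ X K↭) (covers X)

  -- Opaque so that type checking never unfolds the search over all subsets.
  opaque
    maximal-labelled : (Q : LabelledSet → Set) → (∀ L → Dec (Q L)) →
                       (∀ {X t ℓ ℓ′} → Q (labelledSet X t ℓ) → Q (labelledSet X t ℓ′)) →
                       (f : Subset n → ℕ) → (L : LabelledSet) → Q L →
                       Σ LabelledSet λ M → Q M × (∀ L′ → Q L′ → f (set L′) ≤ f (set M))
    maximal-labelled Q Q? Q-irr f L qL with argmax-exists candidates complete P? (f ∘ proj₁) ((set L , label L) , labelled L , qL)
      where
      candidates : List (Subset n × Fin n)
      candidates = cartesianProduct (subsets n) (allFin n)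
      complete : ∀ c → c ∈ candidates
      complete (X , t) = ∈-cartesianProduct⁺ (∈-subsets X) (∈-allFin t)
      P : Subset n × Fin n → Set
      P (X , t) = Σ (Labelled (Vec.lookup X) t) λ ℓ → Q (labelledSet X t ℓ)
      P? : ∀ c → Dec (P c)
      P? (X , t) with labelled? (Vec.lookup X) t
      ... | no ¬ℓ = no (¬ℓ ∘ proj₁)
      ... | yes ℓ with Q? (labelledSet X t ℓ)
      ...   | yes q = yes (ℓ , q)
      ...   | no ¬q = no λ (ℓ′ , q′) → ¬q (Q-irr q′)
    ... | (X , t) , (ℓ , q) , max = labelledSet X t ℓ , q , λ L′ q′ → max (set L′ , label L′) (labelled L′ , q′)

-- Uncrossing labelled sets at v

module Splitting {n : ℕ} (T : Fin n → Bool) (r : Fin n → ℕ) (J : EdgeMultiset n)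
                 (v : Fin n) (v∉T : T v ≡ false) (covers : Covers T r J) where

  open Labels T r public

  atV : Edge n → Bool
  atV = crosses (singleton v)

  D : ℕ
  D = dJ J (singleton v)

  σ : LabelledSet → Bool
  σ L = ⟦ L ⟧ v

  -- The side of the cut of L that avoids v: an edge at v crosses L iff its other end lies on it.
  side : LabelledSet → Fin n → Bool
  side L u = ⟦ L ⟧ u xor σ L

  d : LabelledSet → ℕ
  d L = dJ J ⟦ L ⟧

  Dangerous : ℕ → LabelledSet → Set
  Dangerous k L = d L ≤ r (label L) + k

  cover : (L : LabelledSet) → r (label L) ≤ d L
  cover L = subst (_≤ d L) (fλ-labelled (labelled L)) (covers ⟦ L ⟧)

  uncrossing-bound : (L M Z Z′ : LabelledSet) {kL kM c : ℕ} → d Z + d Z′ + c ≤ d L + d M →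
                     r (label Z) + r (label Z′) ≡ r (label L) + r (label M) →
                     Dangerous kL L → Dangerous kM M → d Z + c ≤ r (label Z) + (kL + kM)
  uncrossing-bound L M Z Z′ {kL} {kM} {c} cut r-sum dL dM =
    +-cancelʳ-≤ (r (label Z′)) (d Z + c) (r (label Z) + (kL + kM)) (begin
      d Z + c + r (label Z′)                      ≤⟨ +-monoʳ-≤ (d Z + c) (cover Z′) ⟩
      d Z + c + d Z′                              ≡⟨ xy∙z≈xz∙y (d Z) c (d Z′) ⟩
      d Z + d Z′ + c                              ≤⟨ cut ⟩
      d L + d M                                   ≤⟨ +-mono-≤ dL dM ⟩
      r (label L) + kL + (r (label M) + kM)       ≡⟨ interchange (r (label L)) kL (r (label M)) kM ⟩
      r (label L) + r (label M) + (kL + kM)       ≡⟨ cong (_+ (kL + kM)) r-sum ⟨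
      r (label Z) + r (label Z′) + (kL + kM)      ≡⟨ xy∙z≈xz∙y (r (label Z)) (r (label Z′)) (kL + kM) ⟩
      r (label Z) + (kL + kM) + r (label Z′)      ∎)
    where open ≤-Reasoning

  δᵥ : LabelledSet → Edge n → Bool
  δᵥ L e = atV e ∧ crosses ⟦ L ⟧ e

  dᵥ : LabelledSet → ℕ
  dᵥ L = count (δᵥ L) J

  shared : LabelledSet → LabelledSet → ℕ
  shared L M = count (λ e → δᵥ L e ∧ δᵥ M e) J

  side-v : (L : LabelledSet) → side L v ≡ false
  side-v L = xor-same (σ L)

  d-side : (L : LabelledSet) → d L ≡ dJ J (side L)
  d-side L = dJ-cong J ⟦ L ⟧ (side L) (sym ∘ crosses-shift ⟦ L ⟧ (σ L))

  crosses-side : (L : LabelledSet) {e : Edge n} → atV e ≡ true → crosses ⟦ L ⟧ e ≡ side L (otherEnd v e)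
  crosses-side L atv = trans (crosses-at v atv ⟦ L ⟧) (xor-comm (σ L) _)

  crosses-sides : (op : Bool → Bool → Bool) → op false false ≡ false → (L M : LabelledSet) {e : Edge n} → atV e ≡ true →
                  crosses (side L ⟪ op ⟫ side M) e ≡ op (crosses ⟦ L ⟧ e) (crosses ⟦ M ⟧ e)
  crosses-sides op op-ff L M {e} atv = begin
    crosses (side L ⟪ op ⟫ side M) e                    ≡⟨ crosses-at v atv (side L ⟪ op ⟫ side M) ⟩
    op (side L v) (side M v) xor op (side L o) (side M o)
      ≡⟨ cong₂ (λ x y → op x y xor op (side L o) (side M o)) (side-v L) (side-v M) ⟩
    op false false xor op (side L o) (side M o)         ≡⟨ cong (_xor op (side L o) (side M o)) op-ff ⟩
    op (side L o) (side M o)                            ≡⟨ cong₂ op (crosses-side L atv) (crosses-side M atv) ⟨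
    op (crosses ⟦ L ⟧ e) (crosses ⟦ M ⟧ e)              ∎
    where
    open ≡-Reasoning
    o = otherEnd v e

  combine : (Bool → Bool → Bool) → LabelledSet → LabelledSet → Subset n
  combine op L M = Vec.tabulate (λ u → op (σ L) (σ M) xor op (side L u) (side M u))

  module _ (op : Bool → Bool → Bool) (op-ff : op false false ≡ false) (L M : LabelledSet) where

    private
      Z : Fin n → Bool
      Z = Vec.lookup (combine op L M)

      Z≗ : ∀ u → Z u ≡ op (σ L) (σ M) xor op (side L u) (side M u)
      Z≗ = lookup∘tabulate _

    combine-v : Z v ≡ op (σ L) (σ M)
    combine-v = begin
      Z v                                           ≡⟨ Z≗ v ⟩
      op (σ L) (σ M) xor op (side L v) (side M v)   ≡⟨ cong₂ (λ x y → op (σ L) (σ M) xor op x y) (side-v L) (side-v M) ⟩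
      op (σ L) (σ M) xor op false false             ≡⟨ cong (op (σ L) (σ M) xor_) op-ff ⟩
      op (σ L) (σ M) xor false                      ≡⟨ xor-identityʳ _ ⟩
      op (σ L) (σ M)                                ∎
      where open ≡-Reasoning

    side-combine : ∀ u → Z u xor Z v ≡ op (side L u) (side M u)
    side-combine u = trans (cong₂ _xor_ (Z≗ u) combine-v) (xor-cancelˡ (op (σ L) (σ M)) _)

    labelled-combine : (s : Fin n) → s ≡ label L ⊎ s ≡ label M →
                       (∀ u → op (σ L) (σ M) xor op (⌊ u ≟ label L ⌋ xor σ L) (⌊ u ≟ label M ⌋ xor σ M) ≡ ⌊ u ≟ s ⌋) →
                       Labelled Z s
    labelled-combine s s≡ F≗ = Labelled-cong (sym ∘ Z≗)
      (labelled-⟪⟫ (λ x y → op (σ L) (σ M) xor op (x xor σ L) (y xor σ M)) (labelled L) (labelled M) F≗ s≡)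

    crosses-combine : ∀ e → crosses Z e ≡ crosses (side L ⟪ op ⟫ side M) e
    crosses-combine e = trans (sym (crosses-shift Z (Z v) e)) (crosses-cong side-combine e)

    d-combine : dJ J Z ≡ dJ J (side L ⟪ op ⟫ side M)
    d-combine = dJ-cong J Z (side L ⟪ op ⟫ side M) crosses-combine

    δᵥ-combine : ∀ e → atV e ∧ crosses Z e ≡ op (δᵥ L e) (δᵥ M e)
    δᵥ-combine e with atV e in atv
    ... | false = sym op-ff
    ... | true  = trans (crosses-combine e) (crosses-sides op op-ff L M atv)

  -- Compatible sets uncross into the union and intersection of their sides, incompatible ones
  -- into the two differences of their sides.
  record Compat (L M : LabelledSet) : Set where
    constructor compat
    field
      σ⇒label : σ L ≡ σ M → label L ≡ label M
      label⇒σ : label L ≡ label M → σ L ≡ σ M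

  open Compat

  compat? : (L M : LabelledSet) → Dec (Compat L M)
  compat? L M = map′ (λ (f , g) → compat f g) (λ (compat f g) → f , g)
    ((σ L ≟ᵇ σ M →-dec label L ≟ label M) ×-dec (label L ≟ label M →-dec σ L ≟ᵇ σ M))

  module _ {L M : LabelledSet} where

    compat-sym : Compat L M → Compat M L
    compat-sym (compat σ⇒ label⇒) = compat (λ σ≡ → sym (σ⇒ (sym σ≡))) (λ t≡ → sym (label⇒ (sym t≡)))

    incompat-σ≡ : ¬ Compat L M → σ L ≡ σ M → label L ≢ label M
    incompat-σ≡ ¬c σ≡ t≡ = ¬c (compat (λ _ → t≡) (λ _ → σ≡))

    incompat-σ≢ : ¬ Compat L M → σ L ≢ σ M → label L ≡ label M
    incompat-σ≢ ¬c σ≢ with label L ≟ label M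
    ... | yes t≡ = t≡
    ... | no t≢  = ⊥-elim (¬c (compat (λ σ≡ → ⊥-elim (σ≢ σ≡)) (λ t≡ → ⊥-elim (t≢ t≡))))

  module _ (L M : LabelledSet) where

    private
      same-label : ∀ {u} → ⌊ u ≟ label L ⌋ ≡ true → ⌊ u ≟ label M ⌋ ≡ true → label L ≡ label M
      same-label a b = trans (sym (⌊≟⌋≡true a)) (⌊≟⌋≡true b)

    union : Compat L M → LabelledSet
    union (compat σ⇒ label⇒) = labelledSet (combine _∨_ L M) (if σ L then label L else label M)
      (labelled-combine _∨_ refl L M _ (if-either (σ L)) λ u →
        trans (∨-label _ _ _ _ (λ σ≡ → cong (λ t → ⌊ u ≟ t ⌋) (σ⇒ σ≡)) (λ a b → label⇒ (same-label a b)))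
              (sym (⌊≟if⌋ (σ L))))

    meet : Compat L M → LabelledSet
    meet (compat σ⇒ label⇒) = labelledSet (combine _∧_ L M) (if σ L then label M else label L)
      (labelled-combine _∧_ refl L M _ (Sum.swap (if-either (σ L))) λ u →
        trans (∧-label _ _ _ _ (λ σ≡ → cong (λ t → ⌊ u ≟ t ⌋) (σ⇒ σ≡)) (λ a b → label⇒ (same-label a b)))
              (sym (⌊≟if⌋ (σ L))))

    private
      Z₁ Z₂ : ¬ Compat L M → LabelledSet
      Z₁ ¬c = labelledSet (combine diff L M) (if σ L then label M else label L)
        (labelled-combine diff refl L M _ (Sum.swap (if-either (σ L))) λ u →
          trans (diff-label _ _ _ _ (λ σ≡ a b → incompat-σ≡ ¬c σ≡ (same-label a b))
                                    (λ σ≢ → cong (λ t → ⌊ u ≟ t ⌋) (incompat-σ≢ ¬c σ≢)))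
                (sym (⌊≟if⌋ (σ L))))
      Z₂ ¬c = labelledSet (combine diff M L) (if σ M then label L else label M)
        (labelled-combine diff refl M L _ (Sum.swap (if-either (σ M))) λ u →
          trans (diff-label _ _ _ _ (λ σ≡ a b → incompat-σ≡ ¬c (sym σ≡) (same-label b a))
                                    (λ σ≢ → cong (λ t → ⌊ u ≟ t ⌋) (sym (incompat-σ≢ ¬c (σ≢ ∘ sym)))))
                (sym (⌊≟if⌋ (σ M))))

    σ-union : (c : Compat L M) → σ (union c) ≡ σ L ∨ σ M
    σ-union c = combine-v _∨_ refl L M

    δᵥ-union : (c : Compat L M) → ∀ e → δᵥ (union c) e ≡ δᵥ L e ∨ δᵥ M e
    δᵥ-union c = δᵥ-combine _∨_ refl L M

    union-dangerous : ∀ {kL kM} (c : Compat L M) → Dangerous kL L → Dangerous kM M → Dangerous (kL + kM) (union c)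
    union-dangerous {kL} {kM} c dL dM =
      subst (_≤ r (label (union c)) + (kL + kM)) (+-identityʳ (d (union c)))
        (uncrossing-bound L M (union c) (meet c) cut (r-swap (σ L)) dL dM)
      where
      open ≤-Reasoning
      cut : d (union c) + d (meet c) + 0 ≤ d L + d M
      cut = begin
        d (union c) + d (meet c) + 0                               ≡⟨ +-identityʳ _ ⟩
        d (union c) + d (meet c)                                   ≡⟨ cong₂ _+_ (d-combine _∨_ refl L M) (d-combine _∧_ refl L M) ⟩
        dJ J (side L ⟪ _∨_ ⟫ side M) + dJ J (side L ⟪ _∧_ ⟫ side M) ≡⟨ +-comm (dJ J (side L ⟪ _∨_ ⟫ side M)) _ ⟩
        dJ J (side L ⟪ _∧_ ⟫ side M) + dJ J (side L ⟪ _∨_ ⟫ side M) ≤⟨ submodular J (side L) (side M) ⟩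
        dJ J (side L) + dJ J (side M)                              ≡⟨ cong₂ _+_ (d-side L) (d-side M) ⟨
        d L + d M                                                  ∎
      r-swap : ∀ s → r (if s then label L else label M) + r (if s then label M else label L) ≡ r (label L) + r (label M)
      r-swap true  = refl
      r-swap false = +-comm (r (label M)) (r (label L))

    shared-bound : ∀ {kL kM} → ¬ Compat L M → Dangerous kL L → Dangerous kM M → 2 * shared L M ≤ kL + kM
    shared-bound ¬c dL dM =
      +-cancelˡ-≤ (r (label (Z₁ ¬c))) _ _
        (≤-trans (+-monoˡ-≤ _ (cover (Z₁ ¬c)))
                 (uncrossing-bound L M (Z₁ ¬c) (Z₂ ¬c) cut r-sum dL dM))
      where
      open ≤-Reasoning
      between : Edge n → Bool
      between e = crosses (side L ⟪ _∧_ ⟫ side M) e ∧ crosses (side L ⟪ _∨_ ⟫ side M) e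
      shared≤between : shared L M ≤ count between J
      shared≤between = count-mono J λ {e} _ both → between-if-both e both
        where
        between-if-both : ∀ e → δᵥ L e ∧ δᵥ M e ≡ true → between e ≡ true
        between-if-both e both =
          cong₂ _∧_ (trans (crosses-sides _∧_ refl L M atv) (cong₂ _∧_ cL cM))
                    (trans (crosses-sides _∨_ refl L M atv) (cong₂ _∨_ cL cM))
          where
          atv : atV e ≡ true
          atv = proj₁ (∧-true (proj₁ (∧-true {δᵥ L e} both)))
          cL : crosses ⟦ L ⟧ e ≡ true
          cL = proj₂ (∧-true {atV e} (proj₁ (∧-true {δᵥ L e} both)))
          cM : crosses ⟦ M ⟧ e ≡ true
          cM = proj₂ (∧-true {atV e} (proj₂ (∧-true {δᵥ L e} both)))
      cut : d (Z₁ ¬c) + d (Z₂ ¬c) + 2 * shared L M ≤ d L + d M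
      cut = begin
        d (Z₁ ¬c) + d (Z₂ ¬c) + 2 * shared L M
          ≡⟨ cong₂ (λ x y → x + y + 2 * shared L M) (d-combine diff refl L M) (d-combine diff refl M L) ⟩
        dJ J (side L ⟪ diff ⟫ side M) + dJ J (side M ⟪ diff ⟫ side L) + 2 * shared L M
          ≤⟨ +-monoʳ-≤ (dJ J (side L ⟪ diff ⟫ side M) + dJ J (side M ⟪ diff ⟫ side L)) (*-monoʳ-≤ 2 shared≤between) ⟩
        dJ J (side L ⟪ diff ⟫ side M) + dJ J (side M ⟪ diff ⟫ side L) + 2 * count between J
          ≤⟨ posimodular J (side L) (side M) ⟩
        dJ J (side L) + dJ J (side M)
          ≡⟨ cong₂ _+_ (d-side L) (d-side M) ⟨
        d L + d M ∎
      r-sum : r (label (Z₁ ¬c)) + r (label (Z₂ ¬c)) ≡ r (label L) + r (label M)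
      r-sum = r-cross (σ L) (σ M) (incompat-σ≢ ¬c)
        where
        r-cross : ∀ s s′ {a b} → (s ≢ s′ → a ≡ b) → r (if s then b else a) + r (if s′ then a else b) ≡ r a + r b
        r-cross true  true  {a} {b} _ = +-comm (r b) (r a)
        r-cross false false _ = refl
        r-cross true  false a≡b rewrite a≡b (λ ()) = refl
        r-cross false true  a≡b rewrite a≡b (λ ()) = refl


  compatible-if-shared : ∀ L M {kL kM e} → Dangerous kL L → Dangerous kM M → kL + kM ≤ 1 →
                         e ∈ J → δᵥ L e ≡ true → δᵥ M e ≡ true → Compat L M
  compatible-if-shared L M dL dM k≤1 e∈J eL eM with compat? L M
  ... | yes c  = c
  ... | no ¬c = ⊥-elim (true≢false (trans (sym (cong₂ _∧_ eL eM))
                                  (count-≡0 J (double≤1⇒≡0 (≤-trans (shared-bound L M ¬c dL dM) k≤1)) e∈J)))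

  -- Toggling v keeps the label since v ∉ T.
  flip : LabelledSet → LabelledSet
  flip L = labelledSet (Vec.tabulate (⟦ L ⟧ ⟪ _xor_ ⟫ singleton v)) (label L)
                 (Labelled-cong (sym ∘ lookup∘tabulate _) toggled)
    where
    toggled : Labelled (⟦ L ⟧ ⟪ _xor_ ⟫ singleton v) (label L)
    toggled u with u ≟ v
    ... | no _     = trans (cong (_∧ T u) (xor-identityʳ (⟦ L ⟧ u))) (labelled L u)
    ... | yes refl = begin
      (⟦ L ⟧ v xor true) ∧ T v ≡⟨ cong (_ ∧_) v∉T ⟩
      (⟦ L ⟧ v xor true) ∧ false ≡⟨ ∧-zeroʳ _ ⟩
      false                      ≡⟨ ∧-zeroʳ _ ⟨
      ⟦ L ⟧ v ∧ false            ≡⟨ cong (_ ∧_) v∉T ⟨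
      ⟦ L ⟧ v ∧ T v              ≡⟨ labelled L v ⟩
      ⌊ v ≟ label L ⌋            ∎
      where open ≡-Reasoning

  d-flip : (L : LabelledSet) → d (flip L) + 2 * dᵥ L ≡ d L + D
  d-flip L = begin
    d (flip L) + 2 * dᵥ L
      ≡⟨ cong (_+ 2 * dᵥ L) (trans (dJ-cong J ⟦ flip L ⟧ (⟦ L ⟧ ⟪ _xor_ ⟫ singleton v) (crosses-cong (lookup∘tabulate _)))
                                   (dJ≡count J (⟦ L ⟧ ⟪ _xor_ ⟫ singleton v))) ⟩
    count (crosses (⟦ L ⟧ ⟪ _xor_ ⟫ singleton v)) J + 2 * dᵥ L
      ≡⟨ trans (Σ-+ (𝟙 ∘ crosses (⟦ L ⟧ ⟪ _xor_ ⟫ singleton v)) (λ e → 2 * 𝟙 (δᵥ L e)) J)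
               (cong (count (crosses (⟦ L ⟧ ⟪ _xor_ ⟫ singleton v)) J +_) (Σ-* 2 (𝟙 ∘ δᵥ L) J)) ⟨
    Σ⟨ (λ e → 𝟙 (crosses (⟦ L ⟧ ⟪ _xor_ ⟫ singleton v) e) + 2 * 𝟙 (δᵥ L e)) ⟩ J
      ≡⟨ Σ-cong J (λ (p , q) → edge (⟦ L ⟧ p) (⟦ L ⟧ q) (singleton v p) (singleton v q)) ⟩
    Σ⟨ (λ e → 𝟙 (crosses ⟦ L ⟧ e) + 𝟙 (atV e)) ⟩ J
      ≡⟨ Σ-+ (𝟙 ∘ crosses ⟦ L ⟧) (𝟙 ∘ atV) J ⟩
    count (crosses ⟦ L ⟧) J + count atV J
      ≡⟨ cong₂ _+_ (dJ≡count J ⟦ L ⟧) (dJ≡count J (singleton v)) ⟨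
    d L + D ∎
    where
    open ≡-Reasoning
    edge : ∀ a₁ a₂ s₁ s₂ → 𝟙 ((a₁ xor s₁) xor (a₂ xor s₂)) + 2 * 𝟙 ((s₁ xor s₂) ∧ (a₁ xor a₂)) ≡ 𝟙 (a₁ xor a₂) + 𝟙 (s₁ xor s₂)
    edge = decide (∀? λ _ → ∀? λ _ → ∀? λ _ → ∀? λ _ → _ ≟ℕ _)

  dᵥ-bound : ∀ {k} (L : LabelledSet) → Dangerous k L → 2 * dᵥ L ≤ k + D
  dᵥ-bound {k} L dL = +-cancelˡ-≤ (r (label L)) _ _ (begin
    r (label L) + 2 * dᵥ L     ≤⟨ +-monoˡ-≤ (2 * dᵥ L) (cover (flip L)) ⟩
    d (flip L) + 2 * dᵥ L      ≡⟨ d-flip L ⟩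
    d L + D                    ≤⟨ +-monoˡ-≤ D dL ⟩
    r (label L) + k + D        ≡⟨ +-assoc (r (label L)) k D ⟩
    r (label L) + (k + D)      ∎)
    where open ≤-Reasoning

  label≡⇒σ≡ : {X A B : LabelledSet} → Compat X A → Compat X B → label A ≡ label B → σ A ≡ σ B
  label≡⇒σ≡ {X} {A} {B} (compat σ⇒A label⇒A) (compat σ⇒B label⇒B) tA≡tB with σ X ≟ᵇ σ A
  ... | yes σX≡σA = trans (sym σX≡σA) (label⇒B (trans (σ⇒A σX≡σA) tA≡tB))
  ... | no σX≢σA  = third-value σX≢σA λ σX≡σB → σX≢σA (label⇒A (trans (σ⇒B σX≡σB) (sym tA≡tB)))
    where
    third-value : ∀ {x y z} → x ≢ y → x ≢ z → y ≡ z
    third-value {x} {y} {z} = decide (∀? λ x → ∀? λ y → ∀? λ z → ¬? (x ≟ᵇ y) →-dec ¬? (x ≟ᵇ z) →-dec y ≟ᵇ z) x y z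

  maximal-absorbs : (M L : LabelledSet) (c : Compat M L) → dᵥ (union M L c) ≤ dᵥ M →
                    ∀ {e} → e ∈ J → δᵥ L e ≡ true → δᵥ M e ≡ true
  maximal-absorbs M L c no-gain {e} e∈J Le with δᵥ M e in Me
  ... | true  = refl
  ... | false = ⊥-elim (<⇒≱ (count-< J M⊆union e∈J union-e Me) no-gain)
    where
    M⊆union : ∀ {x} → x ∈ J → δᵥ M x ≡ true → δᵥ (union M L c) x ≡ true
    M⊆union {x} _ Mx = trans (δᵥ-union M L c x) (cong (_∨ δᵥ L x) Mx)
    union-e : δᵥ (union M L c) e ≡ true
    union-e = trans (δᵥ-union M L c e) (trans (cong (δᵥ M e ∨_) Le) (∨-zeroʳ _))

  d-↭∷ : ∀ {a K} → J ↭ a ∷ K → (X : Fin n → Bool) → dJ J X ≡ 𝟙 (crosses X a) + dJ K X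
  d-↭∷ {a} {K} J↭ X = trans (dJ-↭ X J↭) (dJ-∷ a K X)

  D≡count : D ≡ count atV J
  D≡count = dJ≡count J (singleton v)

  AdmissiblePair : Edge n → Edge n → EdgeMultiset n → Set
  AdmissiblePair a b K = atV a ≡ true × atV b ≡ true × Covers T r (splitEdge v a b ∷ K)

  DeletableEdge : Edge n → EdgeMultiset n → Set
  DeletableEdge a K = atV a ≡ true × Covers T r K

  admissible-pair? : Dec (∃[ a ] ∃[ b ] ∃[ K ] (J ↭ a ∷ b ∷ K × AdmissiblePair a b K))
  admissible-pair? = ∃-removal²? AdmissiblePair (λ K↭ (a , b , c) → a , b , Covers-↭ (prep _ K↭) c)
    (λ a b K → atV a ≟ᵇ true ×-dec atV b ≟ᵇ true ×-dec covers? (splitEdge v a b ∷ K)) J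

  deletable-edge? : Dec (∃[ a ] ∃[ K ] (J ↭ a ∷ K × DeletableEdge a K))
  deletable-edge? = ∃-removal? DeletableEdge (λ K↭ (a , c) → a , Covers-↭ K↭ c) (λ a K → atV a ≟ᵇ true ×-dec covers? K) J

  -- Classes of edges at v

  module NoSplitting
    (no-admissible-pair : ¬ (∃[ a ] ∃[ b ] ∃[ K ] (J ↭ a ∷ b ∷ K × AdmissiblePair a b K)))
    (no-deletable-edge  : ¬ (∃[ a ] ∃[ K ] (J ↭ a ∷ K × DeletableEdge a K)))
    where

    tight-through : ∀ {a} → a ∈ J → atV a ≡ true → ∃ λ L → Dangerous 0 L × δᵥ L a ≡ true
    tight-through {a} a∈J atv with ∈⇒↭∷ a∈J
    ... | K , J↭ with covered-or-deficient K
    ...   | inj₁ covered      = ⊥-elim (no-deletable-edge (a , K , J↭ , atv , covered))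
    ...   | inj₂ (L , short) with crosses ⟦ L ⟧ a in cross | d-↭∷ J↭ ⟦ L ⟧
    ...     | true  | d≡ = L , subst (_≤ r (label L) + 0) (sym d≡) (≤-trans short (≤-reflexive (sym (+-identityʳ _)))) ,
                           cong₂ _∧_ atv cross
    ...     | false | d≡ = ⊥-elim (<⇒≱ short (subst (r (label L) ≤_) d≡ (cover L)))

    near-tight-through : ∀ {a b K} → J ↭ a ∷ b ∷ K → atV a ≡ true → atV b ≡ true →
                         ∃ λ L → Dangerous 1 L × δᵥ L a ≡ true × δᵥ L b ≡ true
    near-tight-through {a} {b} {K} J↭ atva atvb with covered-or-deficient (splitEdge v a b ∷ K)
    ... | inj₁ covered     = ⊥-elim (no-admissible-pair (a , b , K , J↭ , atva , atvb , covered))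
    ... | inj₂ (L , short) = L , dangerous , cong₂ _∧_ atva ca , cong₂ _∧_ atvb cb
      where
      open ≤-Reasoning
      X = ⟦ L ⟧
      d≡ : d L ≡ 𝟙 (crosses X a) + 𝟙 (crosses X b) + dJ K X
      d≡ = trans (d-↭∷ J↭ X) (trans (cong (𝟙 (crosses X a) +_) (dJ-∷ b K X))
                                     (sym (+-assoc (𝟙 (crosses X a)) (𝟙 (crosses X b)) (dJ K X))))
      short′ : 𝟙 (crosses X (splitEdge v a b)) + dJ K X < r (label L)
      short′ = subst (_< r (label L)) (dJ-∷ (splitEdge v a b) K X) short
      both : crosses X a ∧ crosses X b ≡ true
      both with crosses X a ∧ crosses X b in neither
      ... | true  = refl
      ... | false = ⊥-elim (<⇒≱ short′ (begin
        r (label L)                                        ≤⟨ cover L ⟩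
        d L                                                ≡⟨ d≡ ⟩
        𝟙 (crosses X a) + 𝟙 (crosses X b) + dJ K X         ≤⟨ +-monoˡ-≤ (dJ K X) split-bound ⟩
        𝟙 (crosses X (splitEdge v a b)) + dJ K X           ∎))
        where
        split-pair : ∀ z x y → (z xor x) ∧ (z xor y) ≡ false → 𝟙 (z xor x) + 𝟙 (z xor y) ≤ 𝟙 (x xor y)
        split-pair = decide (∀? λ _ → ∀? λ _ → ∀? λ _ → _ ≟ᵇ _ →-dec _ ≤? _)
        at-a = crosses-at v atva X
        at-b = crosses-at v atvb X
        split-bound : 𝟙 (crosses X a) + 𝟙 (crosses X b) ≤ 𝟙 (crosses X (splitEdge v a b))
        split-bound = subst₂ (λ x y → 𝟙 x + 𝟙 y ≤ 𝟙 (crosses X (splitEdge v a b))) (sym at-a) (sym at-b)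
                        (split-pair (X v) _ _ (subst₂ (λ x y → x ∧ y ≡ false) at-a at-b neither))
      ca = proj₁ (∧-true both)
      cb = proj₂ (∧-true {crosses X a} both)
      dangerous : Dangerous 1 L
      dangerous = begin
        d L                          ≡⟨ d≡ ⟩
        𝟙 (crosses X a) + 𝟙 (crosses X b) + dJ K X ≡⟨ cong₂ (λ x y → 𝟙 x + 𝟙 y + dJ K X) ca cb ⟩
        suc (suc (dJ K X))           ≡⟨ +-comm 1 (suc (dJ K X)) ⟩
        suc (dJ K X) + 1             ≤⟨ +-monoˡ-≤ 1 (≤-trans (s≤s (m≤n+m (dJ K X) _)) short′) ⟩
        r (label L) + 1              ∎

    some-edge-at-v : 0 < D → ∃ λ a → a ∈ J × atV a ≡ true
    some-edge-at-v pos = count-pos⇒∃ J (subst (0 <_) D≡count pos)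

    degree≢1 : D ≢ 1
    degree≢1 D≡1 with some-edge-at-v (subst (0 <_) (sym D≡1) (s≤s z≤n))
    ... | a , a∈J , atv with tight-through a∈J atv
    ...   | L , tight , La = true≢false (trans (sym La) (count-≡0 J (double≤1⇒≡0 bound) a∈J))
      where
      bound : 2 * dᵥ L ≤ 1
      bound = subst (2 * dᵥ L ≤_) D≡1 (dᵥ-bound L tight)

    degree≢2 : D ≢ 2
    degree≢2 D≡2 with some-edge-at-v (subst (0 <_) (sym D≡2) (s≤s z≤n))
    ... | a , a∈J , atva with ∈⇒↭∷ a∈J
    ...   | K₁ , J↭aK₁ with count-pos⇒∃ K₁ (subst (0 <_) K₁-count (s≤s z≤n))
      where
      K₁-count : 1 ≡ count atV K₁
      K₁-count = suc-injective (trans (sym D≡2) (trans D≡count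
                   (trans (Σ-↭ (𝟙 ∘ atV) J↭aK₁) (cong (λ x → 𝟙 x + count atV K₁) atva))))
    ...     | b , b∈K₁ , atvb with ∈⇒↭∷ b∈K₁
    ...       | K , K₁↭bK with near-tight-through (↭-trans J↭aK₁ (prep a K₁↭bK)) atva atvb
    ...         | X , near-tight , Xa , Xb = <-irrefl refl (begin
      4                                                   ≤⟨ *-monoʳ-≤ 2 two≤dᵥ ⟩
      2 * dᵥ X                                            ≤⟨ dᵥ-bound X near-tight ⟩
      1 + D                                               ≡⟨ cong (1 +_) D≡2 ⟩
      3                                                   ∎)
      where
      open ≤-Reasoning
      two≤dᵥ : 2 ≤ dᵥ X
      two≤dᵥ = begin
        2                                                   ≡⟨ cong₂ (λ x y → 𝟙 x + 𝟙 y) Xa Xb ⟨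
        𝟙 (δᵥ X a) + 𝟙 (δᵥ X b)                             ≤⟨ +-monoʳ-≤ (𝟙 (δᵥ X a)) (m≤m+n _ _) ⟩
        𝟙 (δᵥ X a) + (𝟙 (δᵥ X b) + count (δᵥ X) K)          ≡⟨ Σ-↭ (𝟙 ∘ δᵥ X) (↭-trans J↭aK₁ (prep a K₁↭bK)) ⟨
        dᵥ X                                                ∎

    record Incident : Set where
      constructor incident
      field
        edge : Edge n
        ∈J   : edge ∈ J
        at-v : atV edge ≡ true

    open Incident

    TightThrough : Edge n → LabelledSet → Set
    TightThrough a L = Dangerous 0 L × δᵥ L a ≡ true

    opaque
      maximal-tight : (a : Incident) →
                      Σ LabelledSet λ M → TightThrough (edge a) M × ∀ L → TightThrough (edge a) L → dᵥ L ≤ dᵥ M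
      maximal-tight a with tight-through (∈J a) (at-v a)
      ... | L , tL = maximal-labelled (TightThrough (edge a))
                       (λ L → d L ≤? r (label L) + 0 ×-dec δᵥ L (edge a) ≟ᵇ true) (λ q → q)
                       (λ X → count (λ e → atV e ∧ crosses (Vec.lookup X) e) J) L tL

    maxTight : Incident → LabelledSet
    maxTight a = proj₁ (maximal-tight a)

    class : Incident → Edge n → Bool
    class a = δᵥ (maxTight a)

    maxTight-tight : (a : Incident) → Dangerous 0 (maxTight a)
    maxTight-tight a = proj₁ (proj₁ (proj₂ (maximal-tight a)))

    maxTight-∋ : (a : Incident) → class a (edge a) ≡ true
    maxTight-∋ a = proj₂ (proj₁ (proj₂ (maximal-tight a)))

    maxTight-absorbs : (a : Incident) {L : LabelledSet} → Dangerous 0 L → Compat (maxTight a) L →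
                       ∀ {e} → e ∈ J → δᵥ L e ≡ true → class a e ≡ true
    maxTight-absorbs a {L} tL c = maximal-absorbs (maxTight a) L c (proj₂ (proj₂ (maximal-tight a)) (union (maxTight a) L c)
      (union-dangerous (maxTight a) L c (maxTight-tight a) tL ,
       trans (δᵥ-union (maxTight a) L c (edge a)) (cong (_∨ δᵥ L (edge a)) (maxTight-∋ a))))

    compat-maxTight : (a : Incident) (X : LabelledSet) → Dangerous 1 X → δᵥ X (edge a) ≡ true → Compat X (maxTight a)
    compat-maxTight a X dX Xa = compatible-if-shared X (maxTight a) dX (maxTight-tight a) ≤-refl (∈J a) Xa (maxTight-∋ a)

    near-tight-through-both : (a b : Incident) → class a (edge b) ≡ false →
                              ∃ λ X → Dangerous 1 X × δᵥ X (edge a) ≡ true × δᵥ X (edge b) ≡ true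
    near-tight-through-both a b ab with ∈-∈-≢⇒↭∷∷ (∈J a) (∈J b) a≢b
      where
      a≢b : edge a ≢ edge b
      a≢b a≡b = true≢false (trans (sym (maxTight-∋ a)) (trans (cong (class a) a≡b) ab))
    ... | K , J↭ = near-tight-through J↭ (at-v a) (at-v b)

    other-class : (a b : Incident) → class a (edge b) ≡ false →
                  σ (maxTight a) ≡ σ (maxTight b) × label (maxTight a) ≢ label (maxTight b)
    other-class a b ab = σ≡ , labels-differ
      where
      incompatible : ¬ Compat (maxTight a) (maxTight b)
      incompatible c = true≢false (trans (sym (maxTight-absorbs a (maxTight-tight b) c (∈J b) (maxTight-∋ b))) ab)
      labels-differ : label (maxTight a) ≢ label (maxTight b)
      labels-differ t≡ with near-tight-through-both a b ab
      ... | X , dX , Xa , Xb =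
        incompatible (compat (λ _ → t≡) (λ _ → label≡⇒σ≡ (compat-maxTight a X dX Xa) (compat-maxTight b X dX Xb) t≡))
      σ≡ : σ (maxTight a) ≡ σ (maxTight b)
      σ≡ = decidable-stable (σ (maxTight a) ≟ᵇ σ (maxTight b)) λ σ≢ → labels-differ (incompat-σ≢ incompatible σ≢)

    outside-class⇒σ≡false : (a b : Incident) → class a (edge b) ≡ false → σ (maxTight a) ≡ false
    outside-class⇒σ≡false a b ab = ≢true⇒≡false (λ σa → refuted σa (near-tight-through-both a b ab))
      where
      σ≡ = proj₁ (other-class a b ab)
      labels-differ = proj₂ (other-class a b ab)
      refuted : σ (maxTight a) ≡ true → (∃ λ X → Dangerous 1 X × δᵥ X (edge a) ≡ true × δᵥ X (edge b) ≡ true) → ⊥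
      refuted σa (X , dX , Xa , Xb) with σ X ≟ᵇ true
      ... | yes σX = labels-differ (trans (sym (σ⇒label (compat-maxTight a X dX Xa) (trans σX (sym σa))))
                                          (σ⇒label (compat-maxTight b X dX Xb) (trans σX (trans (sym σa) σ≡))))
      ... | no _   = labels-differ (trans (sym label-Z) (σ⇒label (compat-maxTight b Z dZ Zb) (trans σZ (trans (sym σa) σ≡))))
        where
        c = compat-sym (compat-maxTight a X dX Xa)
        Z = union (maxTight a) X c
        dZ : Dangerous 1 Z
        dZ = union-dangerous (maxTight a) X c (maxTight-tight a) dX
        Zb : δᵥ Z (edge b) ≡ true
        Zb = trans (δᵥ-union (maxTight a) X c (edge b)) (trans (cong (class a (edge b) ∨_) Xb) (∨-zeroʳ _))
        σZ : σ Z ≡ true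
        σZ = trans (σ-union (maxTight a) X c) (cong (_∨ σ X) σa)
        label-Z : label Z ≡ label (maxTight a)
        label-Z = cong (λ s → if s then label (maxTight a) else label X) σa

    record Envelope (a b : Incident) : Set where
      field
        Z        : LabelledSet
        Z-near   : Dangerous 1 Z
        a-in-Z   : ∀ {e} → e ∈ J → class a e ≡ true → δᵥ Z e ≡ true
        b-in-Z   : ∀ {e} → e ∈ J → class b e ≡ true → δᵥ Z e ≡ true
        outside  : (u : Incident) → δᵥ Z (edge u) ≡ false → ¬ Compat Z (maxTight u) × label (maxTight u) ≡ label Z

    envelope : (a b : Incident) → class a (edge b) ≡ false → Envelope a b
    envelope a b ab with near-tight-through-both a b ab
    ... | X , dX , Xa , Xb = record
      { Z = Z ; Z-near = dZ ; a-in-Z = a-in-Z ; b-in-Z = b-in-Z ; outside = outside }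
      where
      σa : σ (maxTight a) ≡ false
      σa = outside-class⇒σ≡false a b ab
      σb : σ (maxTight b) ≡ false
      σb = trans (sym (proj₁ (other-class a b ab))) σa
      cXa = compat-maxTight a X dX Xa
      cXb = compat-maxTight b X dX Xb

      σX : σ X ≡ true
      σX = ≢false⇒≡true λ σX≡ → proj₂ (other-class a b ab)
             (trans (sym (σ⇒label cXa (trans σX≡ (sym σa)))) (σ⇒label cXb (trans σX≡ (sym σb))))

      Candidate : LabelledSet → Set
      Candidate L = Dangerous 1 L × σ L ≡ true × label L ≡ label X

      maximal-candidate : Σ LabelledSet λ Z → Candidate Z × ∀ L → Candidate L → dᵥ L ≤ dᵥ Z
      maximal-candidate = maximal-labelled Candidate
        (λ L → d L ≤? r (label L) + 1 ×-dec σ L ≟ᵇ true ×-dec label L ≟ label X) (λ q → q)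
        (λ X → count (λ e → atV e ∧ crosses (Vec.lookup X) e) J) X (dX , σX , refl)

      Z : LabelledSet
      Z = proj₁ maximal-candidate
      dZ : Dangerous 1 Z
      dZ = proj₁ (proj₁ (proj₂ maximal-candidate))
      σZ : σ Z ≡ true
      σZ = proj₁ (proj₂ (proj₁ (proj₂ maximal-candidate)))
      ℓZ : label Z ≡ label X
      ℓZ = proj₂ (proj₂ (proj₁ (proj₂ maximal-candidate)))

      Z-absorbs : ∀ M → Dangerous 0 M → Compat Z M → ∀ {e} → e ∈ J → δᵥ M e ≡ true → δᵥ Z e ≡ true
      Z-absorbs M dM c = maximal-absorbs Z M c (proj₂ (proj₂ maximal-candidate) (union Z M c)
        (union-dangerous Z M c dZ dM , trans (σ-union Z M c) (cong (_∨ σ M) σZ) ,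
         trans (cong (λ s → if s then label Z else label M) σZ) ℓZ))

      Z-absorbs-class : (u : Incident) → σ (maxTight u) ≡ false → label (maxTight u) ≢ label X →
                        ∀ {e} → e ∈ J → class u e ≡ true → δᵥ Z e ≡ true
      Z-absorbs-class u σu ℓ≢ = Z-absorbs (maxTight u) (maxTight-tight u)
        (compat (λ σ≡ → ⊥-elim (true≢false (trans (sym σZ) (trans σ≡ σu)))) (λ t≡ → ⊥-elim (ℓ≢ (trans (sym t≡) ℓZ))))

      a-in-Z = Z-absorbs-class a σa λ t≡ → true≢false (trans (sym σX) (trans (label⇒σ cXa (sym t≡)) σa))
      b-in-Z = Z-absorbs-class b σb λ t≡ → true≢false (trans (sym σX) (trans (label⇒σ cXb (sym t≡)) σb))

      outside : (u : Incident) → δᵥ Z (edge u) ≡ false → ¬ Compat Z (maxTight u) × label (maxTight u) ≡ label Z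
      outside u Zu = ¬c , sym (incompat-σ≢ ¬c λ σ≡ → true≢false (trans (sym σZ) (trans σ≡ σu)))
        where
        ¬c : ¬ Compat Z (maxTight u)
        ¬c c = true≢false (trans (sym (Z-absorbs (maxTight u) (maxTight-tight u) c (∈J u) (maxTight-∋ u))) Zu)
        au : class a (edge u) ≡ false
        au = ≢true⇒≡false λ au≡ → true≢false (trans (sym (a-in-Z (∈J u) au≡)) Zu)
        σu : σ (maxTight u) ≡ false
        σu = trans (sym (proj₁ (other-class a u au))) σa

    -- The edges at v that the envelope misses lie in maximal tight sets avoiding v and labelled
    -- like the envelope, so they form a single class.
    large-disjoint-class : (a b : Incident) → class a (edge b) ≡ false → 2 ≤ D →
                           ∃ λ c → shared (maxTight c) (maxTight a) ≡ 0 × shared (maxTight c) (maxTight b) ≡ 0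
                                 × D ≤ 2 * dᵥ (maxTight c) + 1
    large-disjoint-class a b ab 2≤D with envelope a b ab
    ... | H with count-<⇒∃ {P = δᵥ (Envelope.Z H)} {Q = atV} J (subst (dᵥ (Envelope.Z H) <_) D≡count Z<D)
      where
      Z<D : dᵥ (Envelope.Z H) < D
      Z<D = half⇒< {dᵥ (Envelope.Z H)} {D} (dᵥ-bound (Envelope.Z H) (Envelope.Z-near H)) 2≤D
    ...   | e , e∈J , atv , Ze = c , disjoint a a-in-Z , disjoint b b-in-Z , big
      where
      open Envelope H
      c : Incident
      c = incident e e∈J atv

      Z-c-disjoint : shared Z (maxTight c) ≡ 0
      Z-c-disjoint = double≤1⇒≡0 (shared-bound Z (maxTight c) (proj₁ (outside c Ze)) Z-near (maxTight-tight c))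

      disjoint : (u : Incident) → (∀ {e} → e ∈ J → class u e ≡ true → δᵥ Z e ≡ true) → shared (maxTight c) (maxTight u) ≡ 0
      disjoint u u-in-Z = n≤0⇒n≡0 (≤-trans (count-mono {P = λ e → class c e ∧ class u e} {Q = λ e → δᵥ Z e ∧ class c e} J
          λ {f} f∈J both → cong₂ _∧_ (u-in-Z f∈J (proj₂ (∧-true {class c f} both))) (proj₁ (∧-true {class c f} both)))
        (≤-reflexive Z-c-disjoint))

      Z-or-c : ∀ {f} → f ∈ J → atV f ≡ true → δᵥ Z f ∨ class c f ≡ true
      Z-or-c {f} f∈J atvf = ∨-if-not λ Zf → ≢false⇒≡true λ cf →
        proj₂ (other-class c u cf) (trans (proj₂ (outside c Ze)) (sym (proj₂ (outside u Zf))))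
        where u = incident f f∈J atvf

      big : D ≤ 2 * dᵥ (maxTight c) + 1
      big = complement-of-half {D} {dᵥ Z} {dᵥ (maxTight c)} (begin
        D                                           ≡⟨ D≡count ⟩
        count atV J                                 ≤⟨ count-mono J Z-or-c ⟩
        count (λ e → δᵥ Z e ∨ class c e) J          ≤⟨ count-∨ J ⟩
        dᵥ Z + dᵥ (maxTight c)                      ∎) (dᵥ-bound Z Z-near)
        where open ≤-Reasoning

    edge-outside-class : (a : Incident) → 2 ≤ D → ∃ λ b → class a (edge b) ≡ false
    edge-outside-class a 2≤D with count-<⇒∃ J (subst (dᵥ (maxTight a) <_) D≡count a<D)
      where
      a<D : dᵥ (maxTight a) < D
      a<D = half⇒< {dᵥ (maxTight a)} {D} (≤-trans (dᵥ-bound (maxTight a) (maxTight-tight a)) (n≤1+n D)) 2≤D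
    ... | e , e∈J , atv , ae = incident e e∈J atv , ae

    disjoint⇒∉class : ∀ {c a} → shared (maxTight c) (maxTight a) ≡ 0 → class c (edge a) ≡ false
    disjoint⇒∉class {c} {a} disjoint =
      trans (sym (∧-identityʳ _)) (trans (cong (class c (edge a) ∧_) (sym (maxTight-∋ a))) (count-≡0 J disjoint (∈J a)))

    disjoint⇒∉class′ : ∀ {c a} → shared (maxTight c) (maxTight a) ≡ 0 → class a (edge c) ≡ false
    disjoint⇒∉class′ {c} {a} disjoint =
      trans (sym (cong (_∧ class a (edge c)) (maxTight-∋ c))) (count-≡0 J disjoint (∈J c))

    three-disjoint-classes : ∀ {a b c} → shared (maxTight b) (maxTight a) ≡ 0 → shared (maxTight c) (maxTight a) ≡ 0 →
                             shared (maxTight c) (maxTight b) ≡ 0 → dᵥ (maxTight a) + dᵥ (maxTight b) + dᵥ (maxTight c) ≤ D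
    three-disjoint-classes {a} {b} {c} ba ca cb = begin
      dᵥ (maxTight a) + dᵥ (maxTight b) + dᵥ (maxTight c)
        ≡⟨ trans (Σ-+ (λ e → 𝟙 (class a e) + 𝟙 (class b e)) (𝟙 ∘ class c) J)
                 (cong (_+ dᵥ (maxTight c)) (Σ-+ (𝟙 ∘ class a) (𝟙 ∘ class b) J)) ⟨
      Σ⟨ (λ e → 𝟙 (class a e) + 𝟙 (class b e) + 𝟙 (class c e)) ⟩ J
        ≤⟨ Σ-mono J (λ {e} e∈J → at-most-one (class a e) (class b e) (class c e) (atV e) (at-v′ e) (at-v′ e) (at-v′ e)
                                   (count-≡0 J ba e∈J) (count-≡0 J ca e∈J) (count-≡0 J cb e∈J)) ⟩
      count atV J
        ≡⟨ D≡count ⟨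
      D ∎
      where
      open ≤-Reasoning
      at-v′ : ∀ e {b} → atV e ∧ b ≡ true → atV e ≡ true
      at-v′ e = proj₁ ∘ ∧-true {atV e}
      at-most-one : ∀ x y z i → (x ≡ true → i ≡ true) → (y ≡ true → i ≡ true) → (z ≡ true → i ≡ true) →
                    y ∧ x ≡ false → z ∧ x ≡ false → z ∧ y ≡ false → 𝟙 x + 𝟙 y + 𝟙 z ≤ 𝟙 i
      at-most-one = decide (∀? λ x → ∀? λ y → ∀? λ z → ∀? λ i →
        (x ≟ᵇ true →-dec i ≟ᵇ true) →-dec (y ≟ᵇ true →-dec i ≟ᵇ true) →-dec (z ≟ᵇ true →-dec i ≟ᵇ true) →-dec
        _ ≟ᵇ _ →-dec _ ≟ᵇ _ →-dec _ ≟ᵇ _ →-dec _ ≤? _)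

    degree≱4 : 4 ≤ D → ⊥
    degree≱4 4≤D =
      let (e₀ , e₀∈J , at-v₀) = some-edge-at-v (≤-trans (s≤s z≤n) 2≤D)
          a₀ = incident e₀ e₀∈J at-v₀
          (b₀ , a₀b₀) = edge-outside-class a₀ 2≤D
          (c₁ , c₁a₀ , _ , big₁) = large-disjoint-class a₀ b₀ a₀b₀ 2≤D
          (c₂ , c₂c₁ , _ , big₂) = large-disjoint-class c₁ a₀ (disjoint⇒∉class {c₁} {a₀} c₁a₀) 2≤D
          (c₃ , c₃c₁ , c₃c₂ , big₃) = large-disjoint-class c₁ c₂ (disjoint⇒∉class′ {c₂} {c₁} c₂c₁) 2≤D
      in <-irrefl refl (≤-trans 4≤D (three-halves {D} {dᵥ (maxTight c₁)} {dᵥ (maxTight c₂)} {dᵥ (maxTight c₃)}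
                                       big₁ big₂ big₃ (three-disjoint-classes {c₁} {c₂} {c₃} c₂c₁ c₃c₁ c₃c₂)))
      where
      2≤D : 2 ≤ D
      2≤D = ≤-trans (s≤s (s≤s z≤n)) 4≤D

    degree-0-or-3 : D ≡ 0 ⊎ D ≡ 3
    degree-0-or-3 = by-value D refl
      where
      by-value : ∀ k → D ≡ k → D ≡ 0 ⊎ D ≡ 3
      by-value 0 D≡ = inj₁ D≡
      by-value 1 D≡ = ⊥-elim (degree≢1 D≡)
      by-value 2 D≡ = ⊥-elim (degree≢2 D≡)
      by-value 3 D≡ = inj₂ D≡
      by-value (suc (suc (suc (suc k)))) D≡ = ⊥-elim (degree≱4 (subst (4 ≤_) (sym D≡) (s≤s (s≤s (s≤s (s≤s z≤n))))))

  admissible-pair-or-deletable-edge : D ≢ 0 → D ≢ 3 →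
    (∃[ a ] ∃[ b ] ∃[ K ] (J ↭ a ∷ b ∷ K × AdmissiblePair a b K)) ⊎ (∃[ a ] ∃[ K ] (J ↭ a ∷ K × DeletableEdge a K))
  admissible-pair-or-deletable-edge D≢0 D≢3 with admissible-pair? | deletable-edge?
  ... | yes pair | _        = inj₁ pair
  ... | no _     | yes edge = inj₂ edge
  ... | no ¬pair | no ¬edge = ⊥-elim (Sum.[ D≢0 , D≢3 ] (NoSplitting.degree-0-or-3 ¬pair ¬edge))

lemma11 : (n : ℕ) (T : Fin n → Bool) (r : Fin n → ℕ) (J : EdgeMultiset n)
    → Covers T r J
    → (v : Fin n) → T v ≡ false
    → dJ J (singleton v) ≢ 3
    → dJ J (singleton v) ≢ 0
    → (∃[ e ] ∃[ e′ ] ∃[ K ] ((J ↭ (e ∷ e′ ∷ K))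
          × crosses (singleton v) e ≡ true
          × crosses (singleton v) e′ ≡ true
          × Covers T r (splitEdge v e e′ ∷ K)))
      ⊎ (∃[ e ] ∃[ K ] ((J ↭ (e ∷ K))
          × crosses (singleton v) e ≡ true
          × Covers T r K))
lemma11 n T r J covers v v∉T d≢3 d≢0 = Splitting.admissible-pair-or-deletable-edge T r J v v∉T covers d≢0 d≢3
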